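{- Let $G$ be a finite simple graph without isolated vertices and let $T(G)$ be its trimming. Then the Game of Arrows on $G$ is equivalent to the Trimmed Game of Arrows on $T(G)$: there is a bijection from the set of states of $T(G)$ to the set of dormant states of $G$, sending the empty state to the empty state, such that a state $Y$ of $T(G)$ is a follower of a state $X$ of $T(G)$ if and only if the image of $Y$ is a dormant follower of the image of $X$ (so the game trees of the two games are isomorphic).
   Context: For a graph $G$, an arrow is an ordered pair $(v,w)$ with $\{v,w\}\in E(G)$; a decoration is a set $X$ of arrows containing at most one of $(v,w),(w,v)$ for each edge. A vertex $w$ is a sink of $X$ if $(v,w)\in X$ for every neighbor $v$ of $w$, and a source if $(w,v)\in X$ for every neighbor $v$. A leaf is a vertex of degree $1$; other vertices are internal. A state of $G$ is a decoration with no sink or source at an internal vertex; a state is dormant if it has no sinks or sources at all. A follower of a state $X$ is a state $X\cup\{(v,w)\}$ where the edge $\{v,w\}$ carries no arrow in $X$; a dormant follower is a follower which is dormant. The Trimmed Game of Arrows on $G$ starts at the empty state and players alternately move from the current state to a follower; the Game of Arrows on $G$ is the same but moves go from a dormant state to a dormant follower; in both, the player unable to move loses. Ramification: for a graph $G$ and a set $K$ of vertices, $R_K(G)$ has vertex set $(V(G)\setminus K)\cup\{a_x : a\in K, \{a,x\}\in E(G)\}$ and edge set $E(G-K)\cup\{\{a_x,x\}: a\in K, x\notin K, \{a,x\}\in E(G)\}\cup\{\{a_b,b_a\}: a,b\in K, \{a,b\}\in E(G)\}$, where $G-K$ is the subgraph induced by $V(G)\setminus K$. Trimming: let $G'$ be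 the subgraph of $G$ induced by the internal vertices of $G$ and $K$ the set of internal vertices adjacent to a leaf of $G$; then $T(G)=R_K(G')$. The map $R_K(G')\to G'$ that is the identity on $V(G')\setminus K$ and sends each $a_x$ to $a$ induces a bijection between arrows of $T(G)$ and arrows of $G'$, hence between decorations of $T(G)$ and decorations of $G'$ (viewed as decorations of $G$). -}

module Defs where

open import Data.Nat using (ℕ)
open import Data.Fin using (Fin)
open import Data.Bool using (Bool; true; false)
open import Data.Product using (Σ; Σ-syntax; _×_; _,_; proj₁)
open import Data.Sum using (_⊎_; inj₁; inj₂)
open import Data.Empty using (⊥)
open import Relation.Nullary using (¬_)
open import Relation.Binary.PropositionalEquality using (_≡_; refl; sym; trans)
open import Relation.Binary.Bundles using (Setoid)
open import Relation.Binary.Structures using (IsEquivalence)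
open import Data.Refinement using (Refinement; value)
open import Function.Bundles using (_⇔_)

-- Graphs: a vertex type and an adjacency relation.  (Simplicity and
-- finiteness are imposed on the input graph G in the theorem; the
-- trimming T(G) constructed below is then automatically simple/finite.)

record Graph : Set₁ where
  field
    V   : Set
    Adj : V → V → Set
open Graph public

-- A finite simple graph on vertex set Fin n given by a Boolean
-- adjacency matrix (symmetry / irreflexivity are hypotheses of the theorem).
finGraph : (n : ℕ) → (Fin n → Fin n → Bool) → Graph
finGraph n adj = record { V = Fin n ; Adj = λ v w → adj v w ≡ true }

module _ (Γ : Graph) where

  Leaf : V Γ → Set
  Leaf v = Σ[ w ∈ V Γ ] (Adj Γ v w × (∀ u → Adj Γ v u → u ≡ w))

  Internal : V Γ → Set
  Internal v = ¬ Leaf v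

  -- raw decorations: X v w ≡ true  means the arrow (v,w) is in X
  RawDeco : Set
  RawDeco = V Γ → V Γ → Bool

  IsDecoration : RawDeco → Set
  IsDecoration X = (∀ v w → X v w ≡ true → Adj Γ v w)
                 × (∀ v w → X v w ≡ true → X w v ≡ false)

  Sink : RawDeco → V Γ → Set
  Sink X w = ∀ v → Adj Γ v w → X v w ≡ true

  Source : RawDeco → V Γ → Set
  Source X w = ∀ v → Adj Γ w v → X w v ≡ true

  IsState : RawDeco → Set
  IsState X = IsDecoration X
            × (∀ w → Internal w → ¬ Sink X w × ¬ Source X w)

  IsDormant : RawDeco → Set
  IsDormant X = IsDecoration X × (∀ w → ¬ Sink X w × ¬ Source X w)

  emptyDeco : RawDeco
  emptyDeco _ _ = false

  AddsArrow : RawDeco → RawDeco → Set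
  AddsArrow X Y = Σ[ v ∈ V Γ ] Σ[ w ∈ V Γ ]
      (Adj Γ v w × X v w ≡ false × X w v ≡ false
       × (∀ a b → (Y a b ≡ true) ⇔ (X a b ≡ true ⊎ (a ≡ v × b ≡ w))))

  Follower : RawDeco → RawDeco → Set
  Follower X Y = IsState Y × AddsArrow X Y

  DormantFollower : RawDeco → RawDeco → Set
  DormantFollower X Y = Follower X Y × IsDormant Y

  _≐_ : RawDeco → RawDeco → Set
  X ≐ Y = ∀ v w → X v w ≡ Y v w

  ≐-isEquivalence : {P : RawDeco → Set} →
    IsEquivalence {A = Σ RawDeco P} (λ X Y → proj₁ X ≐ proj₁ Y)
  ≐-isEquivalence = record
    { refl  = λ v w → refl
    ; sym   = λ p v w → sym (p v w)
    ; trans = λ p q v w → trans (p v w) (q v w) }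

  States : Setoid _ _
  States = record { Carrier = Σ RawDeco IsState
                  ; _≈_ = λ X Y → proj₁ X ≐ proj₁ Y
                  ; isEquivalence = ≐-isEquivalence }

  DormantStates : Setoid _ _
  DormantStates = record { Carrier = Σ RawDeco IsDormant
                         ; _≈_ = λ X Y → proj₁ X ≐ proj₁ Y
                         ; isEquivalence = ≐-isEquivalence }

-- Induced subgraph on a vertex predicate (proofs are irrelevant, so
-- vertices are determined by their underlying vertex of the big graph).

induced : (Γ : Graph) → (V Γ → Set) → Graph
induced Γ P = record
  { V   = Refinement (V Γ) P
  ; Adj = λ a b → Adj Γ (value a) (value b) }

-- Ramification R_K(H):
--   vertices  inj₁ x        for x ∉ K
--             inj₂ (a , x)  for a ∈ K, {a,x} ∈ E(H)   (the vertex a_x)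
--   edges     E(H - K), {a_x , x} for x ∉ K, {a_b , b_a} for a,b ∈ K.
RamV : (H : Graph) → (V H → Set) → Set
RamV H K = Refinement (V H) (λ x → ¬ K x)
         ⊎ Refinement (V H × V H) (λ p → K (proj₁ p) × Adj H (proj₁ p) (Data.Product.proj₂ p))

RamAdj : (H : Graph) (K : V H → Set) → RamV H K → RamV H K → Set
RamAdj H K (inj₁ x) (inj₁ y) = Adj H (value x) (value y)
RamAdj H K (inj₁ x) (inj₂ p) = value x ≡ Data.Product.proj₂ (value p)
RamAdj H K (inj₂ p) (inj₁ x) = Data.Product.proj₂ (value p) ≡ value x
RamAdj H K (inj₂ p) (inj₂ q) =
  proj₁ (value p) ≡ Data.Product.proj₂ (value q)
  × Data.Product.proj₂ (value p) ≡ proj₁ (value q)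

Ramification : (H : Graph) → (V H → Set) → Graph
Ramification H K = record { V = RamV H K ; Adj = RamAdj H K }

G′ : Graph → Graph
G′ Γ = induced Γ (Internal Γ)

trimK : (Γ : Graph) → V (G′ Γ) → Set
trimK Γ a = Σ[ x ∈ V Γ ] (Adj Γ (value a) x × Leaf Γ x)

Trim : Graph → Graph
Trim Γ = Ramification (G′ Γ) (trimK Γ)

-- The map T(G) → G sending a_x to a identifies the arrows of T(G) with the
-- arrows of G between internal vertices, and decorations are transported
-- along this identification in both directions.  A dormant state of G uses
-- only such arrows, since an arrow at a leaf makes the leaf a sink or a source.
-- Conversely, pushing down a state of T(G) gives a dormant decoration: a leaf
-- of G or a vertex of K has an edge to a leaf, which carries no arrow, and
-- every other vertex of G is an internal vertex of T(G) with the same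
-- neighbourhood.  The new vertices a_x are leaves of T(G), where a state is
-- unconstrained.  Being a bijection on arrows, the identification matches
-- followers with dormant followers.
module Submission where

open import Defs
open import Data.Nat using (ℕ)
open import Data.Fin using (Fin)
open import Data.Fin.Properties using (any?; all?) renaming (_≟_ to _≟ᶠ_)
open import Data.Bool using (Bool; true; false)
open import Data.Bool.Properties using () renaming (_≟_ to _≟ᵇ_)
open import Data.Product using (Σ; Σ-syntax; _×_; _,_; proj₁; proj₂; uncurry; map; swap)
open import Data.Sum using (_⊎_; inj₁; inj₂)
open import Data.Empty using (⊥-elim)
import Data.Empty.Irrelevant as Irrelevant
open import Data.Refinement using (value; _,_)
import Data.Refinement as Refinement
open import Data.Irrelevant using ([_])
open import Function using (_∘_)
open import Function.Bundles using (Bijection; Inverse; Equivalence; _⇔_; mk⇔)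
open import Function.Properties.Inverse using (Inverse⇒Bijection)
open import Relation.Nullary using (¬_; Dec; yes; no)
open import Relation.Nullary.Decidable using (¬?; _×-dec_; _→-dec_; recompute; decidable-stable)
open import Relation.Binary.PropositionalEquality
  using (_≡_; _≢_; refl; sym; trans; cong; cong₂; subst)

module _ (Γ : Graph) where

  decoration-off-edge : ∀ {X v w} → IsDecoration Γ X → ¬ Adj Γ v w → X v w ≡ false
  decoration-off-edge {X} {v} {w} (arrow-adj , _) ¬e with X v w in eq
  ... | true  = ⊥-elim (¬e (arrow-adj v w eq))
  ... | false = refl

  leaf-neighbour-unique : ∀ {v u u′} → Leaf Γ v → Adj Γ v u → Adj Γ v u′ → u ≡ u′
  leaf-neighbour-unique (_ , _ , only) e e′ = trans (only _ e) (sym (only _ e′))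

  dormant⇒state : ∀ {X} → IsDormant Γ X → IsState Γ X
  dormant⇒state (d , none) = d , λ w _ → none w

module _ (Γ : Graph) (adj-sym : ∀ {v w} → Adj Γ v w → Adj Γ w v) where

  dormant-arrow-internal : ∀ {X v w} → IsDormant Γ X → X v w ≡ true →
                           Internal Γ v × Internal Γ w
  dormant-arrow-internal {X} {v} {w} ((arrow-adj , _) , none) x =
      (λ leaf → proj₂ (none v) λ u e →
         subst (λ z → X v z ≡ true) (leaf-neighbour-unique Γ leaf e′ e) x)
    , (λ leaf → proj₁ (none w) λ u e →
         subst (λ z → X z w ≡ true) (leaf-neighbour-unique Γ leaf (adj-sym e′) (adj-sym e)) x)
    where e′ = arrow-adj v w x

  empty-dormant : (∀ v → Σ[ w ∈ V Γ ] Adj Γ v w) → IsDormant Γ (emptyDeco Γ)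
  empty-dormant neighbour =
    ((λ _ _ ()) , (λ _ _ ())) ,
    λ w → (λ sink → false≢true (sink _ (adj-sym (proj₂ (neighbour w)))))
        , (λ source → false≢true (source _ (proj₂ (neighbour w))))
    where
    false≢true : false ≢ true
    false≢true ()

-- An identification of the arrows of Γ with the arrows of Δ over a symmetric
-- relation Liftable; decorations of Γ then correspond to decorations of Δ
-- carried by liftable arrows.
module ArrowTransfer
  {Γ Δ : Graph}
  (base : V Γ → V Δ)
  (adj? : ∀ p q → Dec (Adj Γ p q))
  (Liftable : V Δ → V Δ → Set)
  (liftable? : ∀ v w → Dec (Liftable v w))
  (liftable-sym : ∀ {v w} → Liftable v w → Liftable w v)
  (liftable-adj : ∀ {v w} → Liftable v w → Adj Δ v w)
  (liftable-base : ∀ {p q} → Adj Γ p q → Liftable (base p) (base q))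
  (lift : ∀ {v w} → Liftable v w → V Γ × V Γ)
  (lift-adj : ∀ {v w} (l : Liftable v w) → uncurry (Adj Γ) (lift l))
  (base-lift : ∀ {v w} (l : Liftable v w) → map base base (lift l) ≡ (v , w))
  (lift-swap : ∀ {v w} (l : Liftable v w) → lift (liftable-sym l) ≡ swap (lift l))
  (lift-base : ∀ {p q} (a : Adj Γ p q) (l : Liftable (base p) (base q)) → lift l ≡ (p , q))
  where

  lift-unique : ∀ {p q v w} → Adj Γ p q → (l : Liftable v w) →
                base p ≡ v → base q ≡ w → lift l ≡ (p , q)
  lift-unique a l refl refl = lift-base a l

  lift-irrelevant : ∀ {v w} (l l′ : Liftable v w) → lift l ≡ lift l′
  lift-irrelevant l l′ =
    lift-unique (lift-adj l′) l (cong proj₁ (base-lift l′)) (cong proj₂ (base-lift l′))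

  push : RawDeco Γ → RawDeco Δ
  push Y v w with liftable? v w
  ... | yes l = uncurry Y (lift l)
  ... | no _  = false

  pull : RawDeco Δ → RawDeco Γ
  pull X p q with adj? p q
  ... | yes _ = X (base p) (base q)
  ... | no _  = false

  push-lift : ∀ Y {v w} (l : Liftable v w) → push Y v w ≡ uncurry Y (lift l)
  push-lift Y {v} {w} l with liftable? v w
  ... | yes l′ = cong (uncurry Y) (lift-irrelevant l′ l)
  ... | no ¬l  = ⊥-elim (¬l l)

  push-lift-swap : ∀ Y {v w} (l : Liftable v w) → push Y w v ≡ uncurry Y (swap (lift l))
  push-lift-swap Y l = trans (push-lift Y (liftable-sym l)) (cong (uncurry Y) (lift-swap l))

  push-true : ∀ Y {v w} → push Y v w ≡ true → Σ[ l ∈ Liftable v w ] uncurry Y (lift l) ≡ true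
  push-true Y {v} {w} y with liftable? v w
  ... | yes l = l , y
  push-true Y () | no _

  push-base : ∀ Y {p q} → Adj Γ p q → push Y (base p) (base q) ≡ Y p q
  push-base Y a = trans (push-lift Y (liftable-base a)) (cong (uncurry Y) (lift-base a _))

  push-base-swap : ∀ Y {p q} → Adj Γ p q → push Y (base q) (base p) ≡ Y q p
  push-base-swap Y a =
    trans (push-lift-swap Y (liftable-base a)) (cong (uncurry Y ∘ swap) (lift-base a _))

  push-cong : ∀ {Y Y′} → _≐_ Γ Y Y′ → _≐_ Δ (push Y) (push Y′)
  push-cong {Y} {Y′} Y≐Y′ v w with liftable? v w
  ... | yes l = uncurry Y≐Y′ (lift l)
  ... | no _  = refl

  pull-adj : ∀ X {p q} → Adj Γ p q → pull X p q ≡ X (base p) (base q)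
  pull-adj X {p} {q} a with adj? p q
  ... | yes _ = refl
  ... | no ¬a = ⊥-elim (¬a a)

  pull-true : ∀ X {p q} → pull X p q ≡ true → Adj Γ p q × X (base p) (base q) ≡ true
  pull-true X {p} {q} x with adj? p q
  ... | yes a = a , x
  pull-true X () | no _

  pull-lift : ∀ X {v w} (l : Liftable v w) → uncurry (pull X) (lift l) ≡ X v w
  pull-lift X l = trans (pull-adj X (lift-adj l)) (cong (uncurry X) (base-lift l))

  pull-cong : ∀ {X X′} → _≐_ Δ X X′ → _≐_ Γ (pull X) (pull X′)
  pull-cong {X} {X′} X≐X′ p q with adj? p q
  ... | yes _ = X≐X′ (base p) (base q)
  ... | no _  = refl

  pull-empty : _≐_ Γ (pull (emptyDeco Δ)) (emptyDeco Γ)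
  pull-empty p q with adj? p q
  ... | yes _ = refl
  ... | no _  = refl

  pull-push : ∀ {Y} → IsDecoration Γ Y → _≐_ Γ (pull (push Y)) Y
  pull-push {Y} d p q with adj? p q
  ... | yes a = push-base Y a
  ... | no ¬a = sym (decoration-off-edge Γ d ¬a)

  push-pull : ∀ {X} → (∀ {v w} → X v w ≡ true → Liftable v w) → _≐_ Δ (push (pull X)) X
  push-pull {X} carried v w with liftable? v w
  ... | yes l = pull-lift X l
  ... | no ¬l with X v w in x
  ...   | true  = ⊥-elim (¬l (carried x))
  ...   | false = refl

  push-decoration : ∀ {Y} → IsDecoration Γ Y → IsDecoration Δ (push Y)
  push-decoration {Y} (_ , antisym) =
      (λ v w y → liftable-adj (proj₁ (push-true Y y)))
    , (λ v w y → let (l , y′) = push-true Y y in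
                 trans (push-lift-swap Y l) (antisym _ _ y′))

  pull-decoration : ∀ {X} → IsDecoration Δ X → IsDecoration Γ (pull X)
  pull-decoration {X} (_ , antisym) = (λ p q x → proj₁ (pull-true X x)) , pull-antisym
    where
    pull-antisym : ∀ p q → pull X p q ≡ true → pull X q p ≡ false
    pull-antisym p q x with adj? q p
    ... | yes _ = antisym _ _ (proj₂ (pull-true X x))
    ... | no _  = refl

  open Equivalence using (to; from)

  addsArrow-push⁺ : ∀ {X Y} → AddsArrow Γ X Y → AddsArrow Δ (push X) (push Y)
  addsArrow-push⁺ {X} {Y} (p , q , a , xpq , xqp , step) =
    base p , base q , liftable-adj (liftable-base a) ,
    trans (push-base X a) xpq , trans (push-base-swap X a) xqp , λ v w → mk⇔ (⇒ v w) (⇐ v w)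
    where
    ⇒ : ∀ v w → push Y v w ≡ true → push X v w ≡ true ⊎ (v ≡ base p × w ≡ base q)
    ⇒ v w y with push-true Y y
    ... | l , y′ with to (uncurry step (lift l)) y′
    ...   | inj₁ x = inj₁ (trans (push-lift X l) x)
    ...   | inj₂ (refl , refl) = inj₂ (sym (cong proj₁ (base-lift l)) , sym (cong proj₂ (base-lift l)))

    ⇐ : ∀ v w → push X v w ≡ true ⊎ (v ≡ base p × w ≡ base q) → push Y v w ≡ true
    ⇐ v w (inj₁ x) =
      let (l , x′) = push-true X x in trans (push-lift Y l) (from (uncurry step (lift l)) (inj₁ x′))
    ⇐ v w (inj₂ (refl , refl)) = trans (push-base Y a) (from (step p q) (inj₂ (refl , refl)))

  addsArrow-push⁻ : ∀ {X Y} → IsDecoration Γ X → IsDecoration Γ Y →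
                    AddsArrow Δ (push X) (push Y) → AddsArrow Γ X Y
  addsArrow-push⁻ {X} {Y} (x-adj , _) (y-adj , _) (v , w , _ , xvw , xwv , step) =
    proj₁ (lift l) , proj₂ (lift l) , lift-adj l ,
    trans (sym (push-lift X l)) xvw , trans (sym (push-lift-swap X l)) xwv , λ p q → mk⇔ (⇒ p q) (⇐ p q)
    where
    new = push-true Y (from (step v w) (inj₂ (refl , refl)))
    l = proj₁ new

    ⇒ : ∀ p q → Y p q ≡ true → X p q ≡ true ⊎ (p ≡ proj₁ (lift l) × q ≡ proj₂ (lift l))
    ⇒ p q y with to (step (base p) (base q)) (trans (push-base Y (y-adj p q y)) y)
    ... | inj₁ x = inj₁ (trans (sym (push-base X (y-adj p q y))) x)
    ... | inj₂ (refl , refl) =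
      let lift≡ = lift-unique (y-adj p q y) l refl refl in inj₂ (sym (cong proj₁ lift≡) , sym (cong proj₂ lift≡))

    ⇐ : ∀ p q → X p q ≡ true ⊎ (p ≡ proj₁ (lift l) × q ≡ proj₂ (lift l)) → Y p q ≡ true
    ⇐ p q (inj₁ x) = trans (sym (push-base Y a)) (from (step (base p) (base q)) (inj₁ (trans (push-base X a) x)))
      where a = x-adj p q x
    ⇐ p q (inj₂ (refl , refl)) = proj₂ new

  sink-push⁻ : ∀ {Y p} → Sink Δ (push Y) (base p) → Sink Γ Y p
  sink-push⁻ {Y} sink q a = trans (sym (push-base Y a)) (sink (base q) (liftable-adj (liftable-base a)))

  source-push⁻ : ∀ {Y p} → Source Δ (push Y) (base p) → Source Γ Y p
  source-push⁻ {Y} source q a = trans (sym (push-base Y a)) (source (base q) (liftable-adj (liftable-base a)))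

  push-no-sink : ∀ {Y u w} → Adj Δ u w → ¬ Liftable u w → ¬ Sink Δ (push Y) w
  push-no-sink {Y} e ¬l sink = ¬l (proj₁ (push-true Y (sink _ e)))

  push-no-source : ∀ {Y u w} → Adj Δ w u → ¬ Liftable w u → ¬ Source Δ (push Y) w
  push-no-source {Y} e ¬l source = ¬l (proj₁ (push-true Y (source _ e)))

  sink-pull⁻ : ∀ {X p} → (∀ {u} → Adj Δ u (base p) → Σ[ q ∈ V Γ ] (Adj Γ q p × base q ≡ u)) →
               Sink Γ (pull X) p → Sink Δ X (base p)
  sink-pull⁻ {X} in-lift sink u e with in-lift e
  ... | q , a , refl = trans (sym (pull-adj X a)) (sink q a)

  source-pull⁻ : ∀ {X p} → (∀ {u} → Adj Δ (base p) u → Σ[ q ∈ V Γ ] (Adj Γ p q × base q ≡ u)) →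
                 Source Γ (pull X) p → Source Δ X (base p)
  source-pull⁻ {X} out-lift source u e with out-lift e
  ... | q , a , refl = trans (sym (pull-adj X a)) (source q a)

module Trimming
  (n : ℕ) (adj : Fin n → Fin n → Bool)
  (adj-sym : ∀ v w → adj v w ≡ adj w v)
  (no-isolated : ∀ v → Σ[ w ∈ Fin n ] (adj v w ≡ true))
  where

  G : Graph
  G = finGraph n adj

  T : Graph
  T = Trim G

  ~-sym : ∀ {v w} → Adj G v w → Adj G w v
  ~-sym {v} {w} e = trans (adj-sym w v) e

  _~?_ : ∀ v w → Dec (Adj G v w)
  v ~? w = adj v w ≟ᵇ true

  leaf? : ∀ v → Dec (Leaf G v)
  leaf? v = any? λ w → (v ~? w) ×-dec all? λ u → (v ~? u) →-dec (u ≟ᶠ w)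

  internal? : ∀ v → Dec (Internal G v)
  internal? = ¬? ∘ leaf?

  HasLeaf : Fin n → Set
  HasLeaf v = Σ[ x ∈ Fin n ] (Adj G v x × Leaf G x)

  hasLeaf? : ∀ v → Dec (HasLeaf v)
  hasLeaf? v = any? λ x → (v ~? x) ×-dec leaf? x

  distinct-neighbours : ∀ {v} → Internal G v →
                        Σ[ u ∈ Fin n ] Σ[ u′ ∈ Fin n ] (Adj G v u × Adj G v u′ × u ≢ u′)
  distinct-neighbours {v} iv = second-neighbour (no-isolated v)
    where
    second-neighbour : Σ[ u ∈ Fin n ] Adj G v u → Σ[ u ∈ Fin n ] Σ[ u′ ∈ Fin n ] (Adj G v u × Adj G v u′ × u ≢ u′)
    second-neighbour (u , e) with any? (λ u′ → (v ~? u′) ×-dec ¬? (u′ ≟ᶠ u))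
    ... | yes (u′ , e′ , u′≢u) = u , u′ , e , e′ , u′≢u ∘ sym
    ... | no none = ⊥-elim (iv (u , e , λ u′ e′ → decidable-stable (u′ ≟ᶠ u) λ u′≢u → none (u′ , e′ , u′≢u)))

  inner : (v : Fin n) → .(Internal G v) → V (G′ G)
  inner v iv = v , [ iv ]

  unramified : (v : Fin n) → .(Internal G v) → .(¬ HasLeaf v) → V T
  unramified v iv ¬k = inj₁ (inner v iv , [ ¬k ])

  base : V T → Fin n
  base (inj₁ x) = value (value x)
  base (inj₂ a) = value (proj₁ (value a))

  base-internal : (p : V T) → Internal G (base p)
  base-internal (inj₁ ((x , [ ix ]) , _))       = recompute (internal? x) ix
  base-internal (inj₂ (((a , [ ia ]) , _) , _)) = recompute (internal? a) ia

  base-adj : ∀ {p q} → Adj T p q → Adj G (base p) (base q)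
  base-adj {inj₁ _} {inj₁ _} e = e
  base-adj {inj₁ _} {inj₂ (_ , [ ke ])} refl = ~-sym (recompute (_ ~? _) (proj₂ ke))
  base-adj {inj₂ (_ , [ ke ])} {inj₁ _} refl = recompute (_ ~? _) (proj₂ ke)
  base-adj {inj₂ (_ , [ ke ])} {inj₂ _} (refl , refl) = recompute (_ ~? _) (proj₂ ke)

  adjT-sym : ∀ {p q} → Adj T p q → Adj T q p
  adjT-sym {inj₁ _} {inj₁ _} e = ~-sym e
  adjT-sym {inj₁ _} {inj₂ _} e = sym e
  adjT-sym {inj₂ _} {inj₁ _} e = sym e
  adjT-sym {inj₂ _} {inj₂ _} (e , e′) = sym e′ , sym e

  _≟ᵛ_ : (a b : V (G′ G)) → Dec (a ≡ b)
  _≟ᵛ_ = Refinement._≟_ _≟ᶠ_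

  adjT? : ∀ p q → Dec (Adj T p q)
  adjT? (inj₁ x) (inj₁ y) = value (value x) ~? value (value y)
  adjT? (inj₁ x) (inj₂ b) = value x ≟ᵛ proj₂ (value b)
  adjT? (inj₂ a) (inj₁ y) = proj₂ (value a) ≟ᵛ value y
  adjT? (inj₂ a) (inj₂ b) = (proj₁ (value a) ≟ᵛ proj₂ (value b)) ×-dec (proj₂ (value a) ≟ᵛ proj₁ (value b))

  ramified-leaf : ∀ a → Leaf T (inj₂ a)
  ramified-leaf (((a , ia) , (b , [ ib ])) , [ ke ]) with hasLeaf? b
  ... | yes kb = inj₂ (((b , [ ib ]) , (a , ia)) , [ (kb , ~-sym (proj₂ ke)) ]) , (refl , refl) , only
    where
    only : ∀ q → Adj T (inj₂ (((a , ia) , (b , [ ib ])) , [ ke ])) q → q ≡ _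
    only (inj₁ (_ , [ ¬k ])) refl = Irrelevant.⊥-elim (¬k kb)
    only (inj₂ _) (refl , refl) = refl
  ... | no ¬kb = inj₁ ((b , [ ib ]) , [ ¬kb ]) , refl , only
    where
    only : ∀ q → Adj T (inj₂ (((a , ia) , (b , [ ib ])) , [ ke ])) q → q ≡ _
    only (inj₁ _) refl = refl
    only (inj₂ (_ , [ k′e′ ])) (refl , refl) = Irrelevant.⊥-elim (¬kb (proj₁ k′e′))

  -- The end over v of the edge of T(G) lying over {v, w}: the new vertex v_w
  -- if v ∈ K, and v itself otherwise.
  end : ∀ v w .(iv : Internal G v) .(iw : Internal G w) .(e : Adj G v w) → Dec (HasLeaf v) → V T
  end v w iv iw e (yes k) = inj₂ ((inner v iv , inner w iw) , [ (k , e) ])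
  end v w iv iw e (no ¬k) = unramified v iv ¬k

  base-end : ∀ {v w} .iv .iw .e k → base (end v w iv iw e k) ≡ v
  base-end _ _ _ (yes _) = refl
  base-end _ _ _ (no _)  = refl

  Inner : Fin n → Fin n → Set
  Inner v w = Internal G v × Internal G w × Adj G v w

  inner? : ∀ v w → Dec (Inner v w)
  inner? v w = internal? v ×-dec internal? w ×-dec v ~? w

  inner-sym : ∀ {v w} → Inner v w → Inner w v
  inner-sym (iv , iw , e) = iw , iv , ~-sym e

  inner-base : ∀ {p q} → Adj T p q → Inner (base p) (base q)
  inner-base {p} {q} a = base-internal p , base-internal q , base-adj {p} {q} a

  lift : ∀ {v w} → Inner v w → V T × V T
  lift {v} {w} (iv , iw , e) = end v w iv iw e (hasLeaf? v) , end w v iw iv (~-sym e) (hasLeaf? w)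

  lift-adj : ∀ {v w} (l : Inner v w) → uncurry (Adj T) (lift l)
  lift-adj {v} {w} (iv , iw , e) = end-adj (hasLeaf? v) (hasLeaf? w)
    where
    end-adj : ∀ k k′ → Adj T (end v w iv iw e k) (end w v iw iv (~-sym e) k′)
    end-adj (yes _) (yes _) = refl , refl
    end-adj (yes _) (no _)  = refl
    end-adj (no _)  (yes _) = refl
    end-adj (no _)  (no _)  = e

  lift-unramified : ∀ {v w} (l : Inner v w) (¬k : ¬ HasLeaf v) → proj₁ (lift l) ≡ unramified v (proj₁ l) ¬k
  lift-unramified {v} _ ¬k with hasLeaf? v
  ... | yes k = ⊥-elim (¬k k)
  ... | no _  = refl

  base-lift : ∀ {v w} (l : Inner v w) → map base base (lift l) ≡ (v , w)
  base-lift {v} {w} _ = cong₂ _,_ (base-end _ _ _ (hasLeaf? v)) (base-end _ _ _ (hasLeaf? w))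

  end-base : ∀ {p q} → Adj T p q → (l : Inner (base p) (base q)) → proj₁ (lift l) ≡ p
  end-base {inj₁ ((x , _) , [ ¬k ])} _ _ with hasLeaf? x
  ... | yes k = Irrelevant.⊥-elim (¬k k)
  ... | no _  = refl
  end-base {inj₂ ((a , _) , [ ke ])} _ _ with hasLeaf? (value a)
  ... | no ¬k = Irrelevant.⊥-elim (¬k (proj₁ ke))
  end-base {inj₂ _} {inj₁ _} refl _ | yes _ = refl
  end-base {inj₂ _} {inj₂ _} (refl , refl) _ | yes _ = refl

  lift-base : ∀ {p q} → Adj T p q → (l : Inner (base p) (base q)) → lift l ≡ (p , q)
  lift-base {p} {q} a l = cong₂ _,_ (end-base {p} {q} a l) (end-base {q} {p} (adjT-sym {p} {q} a) (inner-sym l))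

  open ArrowTransfer {T} {G} base adjT? Inner inner? inner-sym (proj₂ ∘ proj₂)
    (λ {p} {q} → inner-base {p} {q}) lift lift-adj base-lift (λ _ → refl) (λ {p} {q} → lift-base {p} {q})
    public

  unramified-out-neighbour : ∀ {x} .ix (¬k : ¬ HasLeaf x) {u} → Adj G x u →
                             Σ[ q ∈ V T ] (Adj T (unramified x ix ¬k) q × base q ≡ u)
  unramified-out-neighbour {x} ix ¬k {u} e =
    proj₂ (lift l) , subst (λ p → Adj T p (proj₂ (lift l))) (lift-unramified l ¬k) (lift-adj l) ,
    cong proj₂ (base-lift l)
    where
    l : Inner x u
    l = recompute (internal? x) ix , (λ leaf → ¬k (u , e , leaf)) , e

  unramified-in-neighbour : ∀ {x} .ix (¬k : ¬ HasLeaf x) {u} → Adj G u x →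
                            Σ[ q ∈ V T ] (Adj T q (unramified x ix ¬k) × base q ≡ u)
  unramified-in-neighbour {x} ix ¬k {u} e =
    proj₁ (lift l) , subst (Adj T (proj₁ (lift l))) (lift-unramified (inner-sym l) ¬k) (lift-adj l) ,
    cong proj₁ (base-lift l)
    where
    l : Inner u x
    l = (λ leaf → ¬k (u , ~-sym e , leaf)) , recompute (internal? x) ix , e

  unramified-internal : ∀ {x} (ix : Internal G x) (¬k : ¬ HasLeaf x) → Internal T (unramified x ix ¬k)
  unramified-internal {x} ix ¬k leaf with distinct-neighbours ix
  ... | u , u′ , e , e′ , u≢u′
      with unramified-out-neighbour ix ¬k e | unramified-out-neighbour ix ¬k e′
  ...   | q , a , refl | q′ , a′ , refl = u≢u′ (cong base (leaf-neighbour-unique T {unramified x ix ¬k} {q} {q′} leaf a a′))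

  dormant-inner : ∀ {X v w} → IsDormant G X → X v w ≡ true → Inner v w
  dormant-inner {X} {v} {w} dX x =
    let (iv , iw) = dormant-arrow-internal G ~-sym dX x in iv , iw , proj₁ (proj₁ dX) v w x

  pull-state : ∀ {X} → IsDormant G X → IsState T (pull X)
  pull-state {X} (d , none) = pull-decoration d , no-sink-source
    where
    no-sink-source : ∀ p → Internal T p → ¬ Sink T (pull X) p × ¬ Source T (pull X) p
    no-sink-source (inj₂ a) internal = ⊥-elim (internal (ramified-leaf a))
    no-sink-source p@(inj₁ ((x , [ ix ]) , [ ¬k ])) _ =
        proj₁ (none x) ∘ sink-pull⁻ {p = p} (unramified-in-neighbour ix ¬k′)
      , proj₂ (none x) ∘ source-pull⁻ {p = p} (unramified-out-neighbour ix ¬k′)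
      where ¬k′ = recompute (¬? (hasLeaf? x)) ¬k

  push-dormant : ∀ {Y} → IsState T Y → IsDormant G (push Y)
  push-dormant {Y} (d , state) = push-decoration d , λ w → no-sink-source w (internal? w) (hasLeaf? w)
    where
    -- an edge at w which is not lifted to T(G) carries no arrow of push Y
    blocked : ∀ {w u} → Adj G w u → ¬ Inner w u → ¬ Sink G (push Y) w × ¬ Source G (push Y) w
    blocked e ¬l = push-no-sink (~-sym e) (¬l ∘ inner-sym) , push-no-source e ¬l

    no-sink-source : ∀ w → Dec (Internal G w) → Dec (HasLeaf w) →
                     ¬ Sink G (push Y) w × ¬ Source G (push Y) w
    no-sink-source w (no leaf) _ = blocked (proj₂ (no-isolated w)) (leaf ∘ proj₁)
    no-sink-source w (yes _) (yes (x , e , leaf)) = blocked e (λ l → proj₁ (proj₂ l) leaf)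
    no-sink-source w (yes iw) (no ¬k) =
      let w* = unramified w iw ¬k
          (¬sink , ¬source) = state w* (unramified-internal iw ¬k)
      in ¬sink ∘ sink-push⁻ {p = w*} , ¬source ∘ source-push⁻ {p = w*}

  push-inverse : Inverse (States T) (DormantStates G)
  push-inverse = record
    { to        = λ Y → push (proj₁ Y) , push-dormant (proj₂ Y)
    ; from      = λ X → pull (proj₁ X) , pull-state (proj₂ X)
    ; to-cong   = λ {Y} {Y′} → push-cong {proj₁ Y} {proj₁ Y′}
    ; from-cong = λ {X} {X′} → pull-cong {proj₁ X} {proj₁ X′}
    ; inverse   = (λ {X} {Y} Y≐pullX v w →
                     trans (push-cong {proj₁ Y} Y≐pullX v w) (push-pull (dormant-inner (proj₂ X)) v w))
                , (λ {Y} {X} X≐pushY p q →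
                     trans (pull-cong {proj₁ X} X≐pushY p q) (pull-push (proj₁ (proj₂ Y)) p q))
    }

  follower⇔dormantFollower : ∀ (X Y : Σ (RawDeco T) (IsState T)) →
    Follower T (proj₁ X) (proj₁ Y) ⇔ DormantFollower G (push (proj₁ X)) (push (proj₁ Y))
  follower⇔dormantFollower (X , sX) (Y , sY) = mk⇔
    (λ (_ , step) → (dormant⇒state G (push-dormant sY) , addsArrow-push⁺ step) , push-dormant sY)
    (λ ((_ , step) , _) → sY , addsArrow-push⁻ (proj₁ sX) (proj₁ sY) step)

mainTheorem3 : (n : ℕ) (adj : Fin n → Fin n → Bool)
    → (∀ v w → adj v w ≡ adj w v)
    → (∀ v → adj v v ≡ false)
    → (∀ v → Σ[ w ∈ Fin n ] (adj v w ≡ true))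
    → Σ[ φ ∈ Bijection (States (Trim (finGraph n adj))) (DormantStates (finGraph n adj)) ]
    ((Σ[ E ∈ Σ (RawDeco (Trim (finGraph n adj))) (IsState (Trim (finGraph n adj))) ]
    (_≐_ (Trim (finGraph n adj)) (proj₁ E) (emptyDeco (Trim (finGraph n adj)))
    × _≐_ (finGraph n adj) (proj₁ (Bijection.to φ E)) (emptyDeco (finGraph n adj))))
    × (∀ X Y → Follower (Trim (finGraph n adj)) (proj₁ X) (proj₁ Y)
    ⇔ DormantFollower (finGraph n adj) (proj₁ (Bijection.to φ X)) (proj₁ (Bijection.to φ Y))))
mainTheorem3 n adj adj-sym _ no-isolated =
    Inverse⇒Bijection push-inverse
  , ((pull (emptyDeco G) , pull-state empty) , pull-empty , push-pull (dormant-inner empty))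
  , follower⇔dormantFollower
  where
  open Trimming n adj adj-sym no-isolated
  empty : IsDormant G (emptyDeco G)
  empty = empty-dormant G ~-sym no-isolated
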